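{- If two modular, l.f.f.c. lattices are isomorphic, then their dissections are isomorphic as modular connected systems.
   Context: A lattice is l.f.f.c. if every closed interval is finite and every element has finitely many upper and lower covers. For $x$ in a modular l.f.f.c. lattice $L$, $x^*=x$ if $x$ is the top of $L$, otherwise the join of all upper covers of $x$; dually $x_*$. A block of $L$ is a maximal (under inclusion) complemented interval $B=[0_B,1_B]$ of $L$. The skeleton $S$ is the set of blocks ordered by $B\le C$ iff $0_B\le 0_C$; it is a lattice. The dissection of $L$ is the modular connected system consisting of skeleton $S$, tolerance $\gamma$ with $B\,\gamma\,C$ iff $B\cap C\ne\emptyset$, blocks $L_B=B$ (ordered as in $L$) for $B\in S$, and, for $B\le C$ with $B\cap C\neq\emptyset$, the connection $\varphi_B^C$ equal to the identity map from $F_B^C=B\cap C$ onto $I_B^C=B\cap C$. For systems $\mathcal C=(S,\gamma,(L_x)_{x\in S},(\varphi_x^y:F_x^y\to I_x^y)_{x\le_\gamma y})$ and $\mathcal C'=(S',\gamma',(L'_x),(\varphi'^y_x:F'^y_x\to I'^y_x))$ (where $x\le_\gamma y$ means $x\le y$ and $x\,\gamma\,y$), an isomorphism is a lattice isomorphism $\chi_S:S\to S'$ with lattice isomorphisms $\chi_x:L_x\to L'_{\chi_S(x)}$ such that $x\,\gamma\,y\iff\chi_S(x)\,\gamma'\,\chi_S(y)$ and, for $x\le_\gamma y$, $F'^{\chi_S(y)}_{\chi_S(x)}=\chi_x(F_x^y)$, $I'^{\chi_S(y)}_{\chi_S(x)}=\chi_y(I_x^y)$, and $\chi_y(\varphi_x^y(a))=\varphi'^{\chi_S(y)}_{\chi_S(x)}(\chi_x(a))$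 for all $a\in F_x^y$. -}

module Defs where

open import Level using (0ℓ)
open import Data.Product using (Σ; ∃; ∃-syntax; _×_; _,_; proj₁; proj₂)
open import Data.List using (List)
open import Data.List.Membership.Propositional using (_∈_)
open import Relation.Binary.Core using (Rel)
open import Relation.Binary.PropositionalEquality using (_≡_)
open import Relation.Binary.Lattice.Structures using (IsLattice)
open import Relation.Nullary using (¬_)
open import Relation.Unary using (Pred)
open import Function.Bundles using (_⤖_; Bijection)

record Lat : Set₁ where
  field
    Carrier   : Set
    _≤_       : Rel Carrier 0ℓ
    _∨_       : Carrier → Carrier → Carrier
    _∧_       : Carrier → Carrier → Carrier
    isLattice : IsLattice _≡_ _≤_ _∨_ _∧_

record LatIso (L L' : Lat) : Set where
  open Lat
  field
    bij    : Carrier L ⤖ Carrier L'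
    pres-∨ : ∀ x y → Bijection.to bij (_∨_ L x y) ≡ _∨_ L' (Bijection.to bij x) (Bijection.to bij y)
    pres-∧ : ∀ x y → Bijection.to bij (_∧_ L x y) ≡ _∧_ L' (Bijection.to bij x) (Bijection.to bij y)

module LatticeNotions (L : Lat) where
  open Lat L

  _<_ : Rel Carrier 0ℓ
  x < y = x ≤ y × ¬ (x ≡ y)

  _⋖_ : Rel Carrier 0ℓ
  x ⋖ y = x < y × (∀ z → x < z → ¬ (z < y))

  InInterval : Carrier → Carrier → Carrier → Set
  InInterval a b x = a ≤ x × x ≤ b

  FiniteSubset : (Carrier → Set) → Set
  FiniteSubset P = ∃[ xs ] (∀ x → P x → x ∈ xs)

  IsModular : Set
  IsModular = ∀ a b c → a ≤ c → (a ∨ (b ∧ c)) ≡ ((a ∨ b) ∧ c)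

  IsLFFC : Set
  IsLFFC = (∀ a b → FiniteSubset (InInterval a b))
         × (∀ x → FiniteSubset (λ y → x ⋖ y))
         × (∀ x → FiniteSubset (λ y → y ⋖ x))

  IsComplementedInterval : Carrier → Carrier → Set
  IsComplementedInterval a b =
    a ≤ b × (∀ x → InInterval a b x →
               ∃[ y ] (InInterval a b y × (x ∧ y) ≡ a × (x ∨ y) ≡ b))

  _⊆I_ : Carrier × Carrier → Carrier × Carrier → Set
  (a , b) ⊆I (c , d) = ∀ x → InInterval a b x → InInterval c d x

  IsBlock : Carrier → Carrier → Set
  IsBlock a b = IsComplementedInterval a b
              × (∀ c d → IsComplementedInterval c d → (a , b) ⊆I (c , d) → (c , d) ⊆I (a , b))

  record Block : Set where
    constructor block
    field
      bot     : Carrier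
      top     : Carrier
      isBlock : IsBlock bot top

  open Block public

  InBlock : Block → Carrier → Set
  InBlock B = InInterval (bot B) (top B)

  Elem : Block → Set
  Elem B = Σ Carrier (InBlock B)

-- Order isomorphisms between (pre)ordered types.  Surjectivity is up to
-- the equivalence "≤ both ways", which for the partial orders below
-- (skeleton, blocks) is equality of elements.

record OrderIso (A : Set) (_≤A_ : Rel A 0ℓ) (B : Set) (_≤B_ : Rel B 0ℓ) : Set where
  field
    fun     : A → B
    mono    : ∀ x y → x ≤A y → fun x ≤B fun y
    reflect : ∀ x y → fun x ≤B fun y → x ≤A y
    surj    : ∀ b → ∃[ a ] (fun a ≤B b × b ≤B fun a)

record System : Set₁ where
  field
    S    : Set
    _≤S_ : Rel S 0ℓ
    γ    : Rel S 0ℓ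
    Lx   : S → Set
    Le   : (x : S) → Rel (Lx x) 0ℓ
    F    : (x y : S) → x ≤S y → γ x y → Pred (Lx x) 0ℓ
    I    : (x y : S) → x ≤S y → γ x y → Pred (Lx y) 0ℓ
    φ    : (x y : S) (p : x ≤S y) (g : γ x y) (a : Lx x) → F x y p g a → Lx y

ImageEq : {A B : Set} (_≤B_ : Rel B 0ℓ) (f : A → B) → (A → Set) → (B → Set) → Set
ImageEq {A} {B} _≤B_ f P P' =
    (∀ a → P a → P' (f a))
  × (∀ b → P' b → ∃[ a ] (P a × f a ≤B b × b ≤B f a))

record SysIso (C C' : System) : Set where
  open System
  field
    χS    : OrderIso (S C) (_≤S_ C) (S C') (_≤S_ C')
  χs : S C → S C'
  χs = OrderIso.fun χS
  field
    χ     : (x : S C) → OrderIso (Lx C x) (Le C x) (Lx C' (χs x)) (Le C' (χs x))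
    γ-iff : ∀ x y → (γ C x y → γ C' (χs x) (χs y)) × (γ C' (χs x) (χs y) → γ C x y)
    F-eq  : ∀ x y (p : _≤S_ C x y) (g : γ C x y)
              (p' : _≤S_ C' (χs x) (χs y)) (g' : γ C' (χs x) (χs y)) →
              ImageEq (Le C' (χs x)) (OrderIso.fun (χ x)) (F C x y p g) (F C' (χs x) (χs y) p' g')
    I-eq  : ∀ x y (p : _≤S_ C x y) (g : γ C x y)
              (p' : _≤S_ C' (χs x) (χs y)) (g' : γ C' (χs x) (χs y)) →
              ImageEq (Le C' (χs y)) (OrderIso.fun (χ y)) (I C x y p g) (I C' (χs x) (χs y) p' g')
    φ-comm : ∀ x y (p : _≤S_ C x y) (g : γ C x y)
              (p' : _≤S_ C' (χs x) (χs y)) (g' : γ C' (χs x) (χs y))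
              (a : Lx C x) (h : F C x y p g a)
              (h' : F C' (χs x) (χs y) p' g' (OrderIso.fun (χ x) a)) →
              Le C' (χs y) (OrderIso.fun (χ y) (φ C x y p g a h))
                           (φ C' (χs x) (χs y) p' g' (OrderIso.fun (χ x) a) h')
            × Le C' (χs y) (φ C' (χs x) (χs y) p' g' (OrderIso.fun (χ x) a) h')
                           (OrderIso.fun (χ y) (φ C x y p g a h))

dissection : Lat → System
dissection L = record
  { S    = Block
  ; _≤S_ = λ B C → bot B ≤ bot C
  ; γ    = λ B C → ∃[ x ] (InBlock B x × InBlock C x)
  ; Lx   = Elem
  ; Le   = λ B a b → proj₁ a ≤ proj₁ b
  ; F    = λ B C _ _ a → InBlock C (proj₁ a)
  ; I    = λ B C _ _ b → InBlock B (proj₁ b)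
  ; φ    = λ B C _ _ a h → (proj₁ a , h)
  }
  where
    open Lat L
    open LatticeNotions L

Modular : Lat → Set
Modular L = LatticeNotions.IsModular L

LFFC : Lat → Set
LFFC L = LatticeNotions.IsLFFC L

{-# OPTIONS --safe #-}
-- A lattice isomorphism preserves and reflects the order, joins and meets.  Hence it
-- maps complemented intervals onto complemented intervals, and, maximality under
-- inclusion being an order-theoretic property, blocks onto blocks.  Transporting blocks
-- and their elements along it is the isomorphism of dissections: the connections are
-- identity maps on intersections B ∩ C, so they commute with the transport for free.
module Submission where

open import Defs
open import Level using (0ℓ)
open import Algebra.Core using (Op₂)
open import Data.Product using (_×_; _,_; proj₁; proj₂)
open import Function.Bundles using (Bijection)
open import Function.Construct.Symmetry using (⤖-sym)
open import Relation.Binary.Lattice.Bundles using (JoinSemilattice)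
open import Relation.Binary.Lattice.Structures using (IsLattice)
import Relation.Binary.Lattice.Properties.JoinSemilattice as JoinSemilatticeProperties
open import Relation.Binary.PropositionalEquality
open ≡-Reasoning

module LatProperties (L : Lat) where
  open Lat L
  open IsLattice isLattice using (reflexive; x≤x∨y; isJoinSemilattice)

  joinSemilattice : JoinSemilattice 0ℓ 0ℓ 0ℓ
  joinSemilattice = record
    { Carrier = Carrier ; _≈_ = _≡_ ; _≤_ = _≤_ ; _∨_ = _∨_
    ; isJoinSemilattice = isJoinSemilattice }

  x≤y⇒x∨y≡y : ∀ {x y} → x ≤ y → x ∨ y ≡ y
  x≤y⇒x∨y≡y = JoinSemilatticeProperties.x≤y⇒x∨y≈y joinSemilattice

  x∨y≡y⇒x≤y : ∀ {x y} → x ∨ y ≡ y → x ≤ y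
  x∨y≡y⇒x≤y {x} {y} x∨y≡y = subst (x ≤_) x∨y≡y (x≤x∨y x y)

  ≡⇒≤×≥ : ∀ {x y} → x ≡ y → x ≤ y × y ≤ x
  ≡⇒≤×≥ x≡y = reflexive x≡y , reflexive (sym x≡y)

module LatIsoProperties {L L' : Lat} (φ : LatIso L L') where
  open Lat L
  private
    module T = Lat L'
  open LatIso φ
  open LatProperties L
  private
    module TP = LatProperties L'

  to : Carrier → T.Carrier
  to = Bijection.to bij

  from : T.Carrier → Carrier
  from = Bijection.to (⤖-sym bij)

  to-from : ∀ y → to (from y) ≡ y
  to-from y = proj₂ (Bijection.surjective bij y) refl

  to-injective : ∀ {x y} → to x ≡ to y → x ≡ y
  to-injective = Bijection.injective bij

  from-to : ∀ x → from (to x) ≡ x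
  from-to x = to-injective (to-from (to x))

  to-mono : ∀ {x y} → x ≤ y → to x T.≤ to y
  to-mono {x} {y} x≤y = TP.x∨y≡y⇒x≤y (begin
    to x T.∨ to y  ≡⟨ pres-∨ x y ⟨
    to (x ∨ y)     ≡⟨ cong to (x≤y⇒x∨y≡y x≤y) ⟩
    to y           ∎)

  to-cancel-≤ : ∀ {x y} → to x T.≤ to y → x ≤ y
  to-cancel-≤ {x} {y} tx≤ty = x∨y≡y⇒x≤y (to-injective (begin
    to (x ∨ y)     ≡⟨ pres-∨ x y ⟩
    to x T.∨ to y  ≡⟨ TP.x≤y⇒x∨y≡y tx≤ty ⟩
    to y           ∎))

  from-homomorphic₂ : (_∙_ : Op₂ Carrier) (_∘_ : Op₂ T.Carrier) →
                      (∀ x y → to (x ∙ y) ≡ to x ∘ to y) →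
                      ∀ x y → from (x ∘ y) ≡ from x ∙ from y
  from-homomorphic₂ _∙_ _∘_ to-homo x y = to-injective (begin
    to (from (x ∘ y))          ≡⟨ to-from (x ∘ y) ⟩
    x ∘ y                      ≡⟨ cong₂ _∘_ (to-from x) (to-from y) ⟨
    to (from x) ∘ to (from y)  ≡⟨ to-homo (from x) (from y) ⟨
    to (from x ∙ from y)       ∎)

LatIso-sym : ∀ {L L'} → LatIso L L' → LatIso L' L
LatIso-sym {L} {L'} φ = record
  { bij    = ⤖-sym bij
  ; pres-∨ = from-homomorphic₂ (Lat._∨_ L) (Lat._∨_ L') pres-∨
  ; pres-∧ = from-homomorphic₂ (Lat._∧_ L) (Lat._∧_ L') pres-∧
  }
  where
    open LatIso φ
    open LatIsoProperties φ

module IntervalTransport {L L' : Lat} (φ : LatIso L L') where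
  open Lat L
  open LatticeNotions L
  private
    module T where
      open Lat L' public
      open LatticeNotions L' public
  open LatIso φ
  open LatIsoProperties φ

  to-InInterval : ∀ {a b x} → InInterval a b x → T.InInterval (to a) (to b) (to x)
  to-InInterval (a≤x , x≤b) = to-mono a≤x , to-mono x≤b

  to-cancel-InInterval : ∀ {a b x} → T.InInterval (to a) (to b) (to x) → InInterval a b x
  to-cancel-InInterval (a≤x , x≤b) = to-cancel-≤ a≤x , to-cancel-≤ x≤b

  from-InInterval : ∀ {a b y} → T.InInterval (to a) (to b) y → InInterval a b (from y)
  from-InInterval {a} {b} {y} y∈ =
    to-cancel-InInterval (subst (T.InInterval (to a) (to b)) (sym (to-from y)) y∈)

  -- A complement of x ∈ [to a, to b] is the image of a complement of from x ∈ [a, b].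
  to-IsComplementedInterval : ∀ {a b} → IsComplementedInterval a b →
                              T.IsComplementedInterval (to a) (to b)
  to-IsComplementedInterval {a} {b} (a≤b , complement) = to-mono a≤b , λ x x∈ →
    let y , y∈ , fx∧y≡a , fx∨y≡b = complement (from x) (from-InInterval x∈)
    in to y , to-InInterval y∈
       , image _∧_ T._∧_ pres-∧ fx∧y≡a , image _∨_ T._∨_ pres-∨ fx∨y≡b
    where
      image : (_∙_ : Op₂ Carrier) (_∘_ : Op₂ T.Carrier) →
              (∀ u v → to (u ∙ v) ≡ to u ∘ to v) →
              ∀ {x y c} → from x ∙ y ≡ c → x ∘ to y ≡ to c
      image _∙_ _∘_ to-homo {x} {y} {c} fx∙y≡c = begin
        x ∘ to y            ≡⟨ cong (_∘ to y) (to-from x) ⟨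
        to (from x) ∘ to y  ≡⟨ to-homo (from x) y ⟨
        to (from x ∙ y)     ≡⟨ cong to fx∙y≡c ⟩
        to c                ∎

module BlockTransport {L L' : Lat} (φ : LatIso L L') where
  open LatticeNotions L
  private
    module T where
      open Lat L' public
      open LatticeNotions L' public
  open LatIsoProperties φ
  open IntervalTransport φ
  private
    module S = IntervalTransport (LatIso-sym φ)

  -- Maximality is checked by pulling [c, d] back along the inverse isomorphism.
  to-IsBlock : ∀ {a b} → IsBlock a b → T.IsBlock (to a) (to b)
  to-IsBlock {a} {b} (complemented , maximal) = to-IsComplementedInterval complemented , to-maximal
    where
      to-maximal : ∀ c d → T.IsComplementedInterval c d →
                   (to a , to b) T.⊆I (c , d) → (c , d) T.⊆I (to a , to b)
      to-maximal c d cd-complemented ab⊆cd y y∈cd =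
        subst (T.InInterval (to a) (to b)) (to-from y)
              (to-InInterval (cd⊆ab (from y) (S.to-InInterval y∈cd)))
        where
          ab⊆cd′ : (a , b) ⊆I (from c , from d)
          ab⊆cd′ x x∈ab = subst (InInterval (from c) (from d)) (from-to x)
                                (S.to-InInterval (ab⊆cd (to x) (to-InInterval x∈ab)))

          cd⊆ab : (from c , from d) ⊆I (a , b)
          cd⊆ab = maximal (from c) (from d) (S.to-IsComplementedInterval cd-complemented) ab⊆cd′

  toBlock : Block → T.Block
  toBlock (block a b isBlock) = T.block (to a) (to b) (to-IsBlock isBlock)

module DissectionTransport {L L' : Lat} (φ : LatIso L L') where
  open Lat L
  open LatticeNotions L
  private
    module T where
      open Lat L' public
      open LatticeNotions L' public
    module TP = LatProperties L'
    module S = BlockTransport (LatIso-sym φ)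
  open LatIsoProperties φ
  open IntervalTransport φ
  open BlockTransport φ

  toElem : ∀ B → Elem B → T.Elem (toBlock B)
  toElem B (x , x∈B) = to x , to-InInterval x∈B

  fromElem : ∀ B → T.Elem (toBlock B) → Elem B
  fromElem B (y , y∈B) = from y , from-InInterval y∈B

  toBlock-orderIso : OrderIso Block (λ B C → bot B ≤ bot C)
                              T.Block (λ B C → T.bot B T.≤ T.bot C)
  toBlock-orderIso = record
    { fun     = toBlock
    ; mono    = λ _ _ → to-mono
    ; reflect = λ _ _ → to-cancel-≤
    ; surj    = λ B → S.toBlock B , TP.≡⇒≤×≥ (to-from (T.bot B))
    }

  toElem-orderIso : ∀ B → OrderIso (Elem B) (λ u v → proj₁ u ≤ proj₁ v)
                                   (T.Elem (toBlock B)) (λ u v → proj₁ u T.≤ proj₁ v)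
  toElem-orderIso B = record
    { fun     = toElem B
    ; mono    = λ _ _ → to-mono
    ; reflect = λ _ _ → to-cancel-≤
    ; surj    = λ v → fromElem B v , TP.≡⇒≤×≥ (to-from (proj₁ v))
    }

  toElem-image-∩ : ∀ B C → ImageEq (λ u v → proj₁ u T.≤ proj₁ v) (toElem B)
                                   (λ u → InBlock C (proj₁ u))
                                   (λ v → T.InBlock (toBlock C) (proj₁ v))
  toElem-image-∩ B C =
    (λ _ → to-InInterval) ,
    λ v v∈C → fromElem B v , from-InInterval v∈C
            , TP.≡⇒≤×≥ (to-from (proj₁ v))

theorem5p30 : (L L' : Lat) → Modular L → LFFC L → Modular L' → LFFC L' →
              LatIso L L' → SysIso (dissection L) (dissection L')
theorem5p30 L L' _ _ _ _ φ = record
  { χS     = toBlock-orderIso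
  ; χ      = toElem-orderIso
  ; γ-iff  = λ B C → (λ (x , x∈B , x∈C) → to x , to-InInterval x∈B , to-InInterval x∈C)
                   , (λ (y , y∈B , y∈C) → from y , from-InInterval y∈B , from-InInterval y∈C)
  ; F-eq   = λ B C _ _ _ _ → toElem-image-∩ B C
  ; I-eq   = λ B C _ _ _ _ → toElem-image-∩ C B
  ; φ-comm = λ _ _ _ _ _ _ _ _ _ → LatProperties.≡⇒≤×≥ L' refl
  }
  where
    open LatIsoProperties φ
    open IntervalTransport φ
    open DissectionTransport φ
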